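{- Let $G=(V,E)$ be a finite undirected graph with $n=|V|$ vertices. For any hierarchical Customizable Hub Labeling $L$ of $G$ and any $\alpha\ge\frac23$, there are at least $\alpha n$ vertices $v$ such that $|L(v)|\ge b_\alpha$.
   Context: A labeling is a function $L\colon V\to 2^V$. A Customizable Hub Labeling (CuHL) satisfies: for any $s,t\in V$ and any $s$-$t$-path $P$ in $G$, $L(s)\cap L(t)$ contains a vertex of $P$. It is hierarchical (HCuHL) if there is a bijective order $\pi\colon V\to\{1,\dots,n\}$ with $u\in L(v)\Rightarrow\pi(u)\ge\pi(v)$. For $\alpha\in[0,1]$, an $\alpha$-balanced separator is a set $S\subseteq V$ such that every connected component of $G[V\setminus S]$ has at most $\alpha n$ vertices; $b_\alpha$ is the minimum size of an $\alpha$-balanced separator of $G$.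
   Formalization: The parameter α takes only rational values. -}

module Defs where

open import Data.Nat using (ℕ; suc; _*_; _≤_; _≥_)
open import Data.Fin using (Fin; toℕ)
open import Data.Fin.Subset using (Subset; _∈_; _∉_; ∣_∣)
open import Data.List using (List; []; _∷_)
open import Data.List.Relation.Unary.All using (All)
open import Data.List.Relation.Unary.Unique.Propositional using (Unique)
open import Data.Product using (Σ; ∃; _×_; _,_)
open import Relation.Binary.PropositionalEquality using (_≡_)
open import Function.Definitions using (Bijective)

record Graph (n : ℕ) : Set₁ where
  field
    Adj : Fin n → Fin n → Set
    Adj-sym : ∀ {u v} → Adj u v → Adj v u
open Graph public

module _ {n : ℕ} (G : Graph n) where

  data Walk : Fin n → Fin n → Set where
    here : ∀ s → Walk s s
    step : ∀ {s u t} → Adj G s u → Walk u t → Walk s t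

  vertices : ∀ {s t} → Walk s t → List (Fin n)
  vertices (here s) = s ∷ []
  vertices (step {s} _ w) = s ∷ vertices w

  IsPath : ∀ {s t} → Walk s t → Set
  IsPath w = Unique (vertices w)

  OnWalk : ∀ {s t} → Fin n → Walk s t → Set
  OnWalk v w = Data.List.Relation.Unary.Any.Any (v ≡_) (vertices w)
    where import Data.List.Relation.Unary.Any

  Labeling : Set
  Labeling = Fin n → Subset n

  IsCuHL : Labeling → Set
  IsCuHL L = ∀ s t (P : Walk s t) → IsPath P →
    ∃ λ v → v ∈ L s × v ∈ L t × OnWalk v P

  -- hierarchical: a bijective order π : V → {1..n} (here Fin n, 0-based)
  IsHierarchical : Labeling → Set
  IsHierarchical L = Σ (Fin n → Fin n) λ π → Bijective _≡_ _≡_ π ×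
    (∀ u v → u ∈ L v → toℕ (π v) ≤ toℕ (π u))

  IsHCuHL : Labeling → Set
  IsHCuHL L = IsCuHL L × IsHierarchical L

  ConnectedAvoiding : Subset n → Fin n → Fin n → Set
  ConnectedAvoiding S v u = Σ (Walk v u) λ w → All (_∉ S) (vertices w)

  -- S is an α-balanced separator, α = p / q: every connected component of
  -- G[V \ S] has at most α n vertices, i.e. every set C of vertices lying in
  -- the component of some v ∉ S satisfies |C| ≤ α n.
  IsBalancedSep : (p q : ℕ) → Subset n → Set
  IsBalancedSep p q S = ∀ v → v ∉ S → ∀ (C : Subset n) →
    (∀ u → u ∈ C → ConnectedAvoiding S v u) → ∣ C ∣ * q ≤ p * n

  IsMinBalSepSize : (p q : ℕ) → ℕ → Set
  IsMinBalSepSize p q b =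
    (Σ (Subset n) λ S → IsBalancedSep p q S × ∣ S ∣ ≡ b) ×
    (∀ S → IsBalancedSep p q S → b ≤ ∣ S ∣)

-- Rank the vertices by the hierarchy π and let U r be the set of vertices of
-- rank ≥ r. Suppose fewer than α n vertices have |L v| ≥ b_α. Then U (r + 1)
-- is α-balanced whenever U r is: otherwise G − U (r + 1) has a component K
-- with more than α n vertices, and every L x with x ∈ K is an α-balanced
-- separator, so |L x| ≥ b_α on all of K. Indeed, by the hub property L x
-- contains every vertex of rank ≥ r reachable from x through lower ranks,
-- so the component of x in G − L x avoids U r and is small because U r is
-- balanced, while any other component is disjoint from K and has at most
-- (1 − α) n ≤ α n vertices. Starting from the trivially balanced U 0 = V,
-- U n = ∅ is balanced, so b_α = 0 and every vertex qualifies after all.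
module Submission where

open import Defs
open import Level using (Level)
open import Data.Nat using (ℕ; zero; suc; _*_; _+_; _∸_; _≤_; _<_; _≤?_; z≤n)
open import Data.Nat.Properties
open import Data.Fin using (Fin; toℕ) renaming (_≟_ to _≟ᶠ_)
open import Data.Fin.Properties using (toℕ<n; toℕ-injective)
open import Data.Fin.Subset using (Subset; _∈_; _∉_; ∣_∣; ⊤; ∁; _⊆_)
open import Data.Fin.Subset.Properties
  using (_∈?_; p⊆q⇒∣p∣≤∣q∣; ∣p∣≤n; ∣⊤∣≡n; ∣∁p∣≡n∸∣p∣; x∉p⇒x∈∁p)
open import Data.Vec using (tabulate)
open import Data.Vec.Properties using (lookup∘tabulate; []=⇒lookup; lookup⇒[]=)
open import Data.List.Relation.Unary.All as All using (All; []; _∷_)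
open import Data.List.Relation.Unary.All.Properties.Core using (¬Any⇒All¬)
open import Data.List.Relation.Unary.Any using (Any; here; there)
open import Data.List.Relation.Unary.AllPairs using ([]; _∷_)
open import Data.Product using (Σ; Σ-syntax; _×_; _,_)
open import Data.Empty using (⊥-elim)
open import Function.Definitions using (Injective)
open import Relation.Unary using (Pred; Decidable)
open import Relation.Nullary using (¬_; yes; no; does)
open import Relation.Nullary.Decidable using (dec-true; decidable-stable; ¬¬-excluded-middle)
open import Relation.Binary.PropositionalEquality using (_≡_; refl; sym; trans; cong; subst; module ≡-Reasoning)

private
  variable
    ℓ : Level

module _ {n : ℕ} (G : Graph n) where
  open import Data.List.Membership.DecPropositional (_≟ᶠ_ {n}) using () renaming (_∈?_ to _∈ₗ?_)

  private
    variable
      P Q : Pred (Fin n) ℓ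
      s t u z z′ : Fin n

  WalkWithin : Pred (Fin n) ℓ → Fin n → Fin n → Set ℓ
  WalkWithin P s t = Σ[ w ∈ Walk G s t ] All P (vertices G w)

  PathWithin : Pred (Fin n) ℓ → Fin n → Fin n → Set ℓ
  PathWithin P s t = Σ[ w ∈ Walk G s t ] IsPath G w × All P (vertices G w)

  within-head : (w : Walk G s t) → All P (vertices G w) → P s
  within-head (here _)   (P-s ∷ _) = P-s
  within-head (step _ _) (P-s ∷ _) = P-s

  within-last : (w : Walk G s t) → All P (vertices G w) → P t
  within-last (here _)   (P-t ∷ []) = P-t
  within-last (step _ w) (_ ∷ P-w)  = within-last w P-w

  within-map : (∀ {z} → P z → Q z) → WalkWithin P s t → WalkWithin Q s t
  within-map f (w , P-w) = w , All.map f P-w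

  within-∷ʳ : WalkWithin P s z → Adj G z z′ → P z′ → WalkWithin P s z′
  within-∷ʳ (here _ , P-s ∷ []) a P-z′ = step a (here _) , P-s ∷ P-z′ ∷ []
  within-∷ʳ (step b w , P-s ∷ P-w) a P-z′ with within-∷ʳ (w , P-w) a P-z′
  ... | w′ , P-w′ = step b w′ , P-s ∷ P-w′

  within-sym : WalkWithin P s t → WalkWithin P t s
  within-sym (here s , P-s) = here s , P-s
  within-sym (step a w , P-s ∷ P-w) = within-∷ʳ (within-sym (w , P-w)) (Adj-sym G a) P-s

  within-trans : WalkWithin P s u → WalkWithin P u t → WalkWithin P s t
  within-trans (here _ , _) w₂ = w₂
  within-trans (step a w , P-s ∷ P-w) w₂ with within-trans (w , P-w) w₂
  ... | w′ , P-w′ = step a w′ , P-s ∷ P-w′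

  within-propagate : (∀ {z z′} → Q z → Adj G z z′ → P z′ → Q z′) →
    Q s → (w : Walk G s t) → All P (vertices G w) → All Q (vertices G w)
  within-propagate closed Q-s (here _) _ = Q-s ∷ []
  within-propagate closed Q-s (step a w) (_ ∷ P-w) =
    Q-s ∷ within-propagate closed (closed Q-s a (within-head w P-w)) w P-w

  path-suffix : (w : Walk G u t) → Any (s ≡_) (vertices G w) →
    IsPath G w → All P (vertices G w) → PathWithin P s t
  path-suffix (here u)   (here refl) w-path P-w = here u , w-path , P-w
  path-suffix (step a w) (here refl) w-path P-w = step a w , w-path , P-w
  path-suffix (step a w) (there s∈w) (_ ∷ w-path) (_ ∷ P-w) = path-suffix w s∈w w-path P-w

  walk⇒path : (w : Walk G s t) → All P (vertices G w) → PathWithin P s t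
  walk⇒path (here s) P-s = here s , [] ∷ [] , P-s
  walk⇒path {s = s} (step a w) (P-s ∷ P-w) with walk⇒path w P-w
  ... | w′ , w′-path , P-w′ with s ∈ₗ? vertices G w′
  ...   | yes s∈w′ = path-suffix w′ s∈w′ w′-path P-w′
  ...   | no  s∉w′ = step a w′ , ¬Any⇒All¬ (vertices G w′) s∉w′ ∷ w′-path , P-s ∷ P-w′

module _ {n : ℕ} {P : Pred (Fin n) ℓ} (P? : Decidable P) where

  decSubset : Subset n
  decSubset = tabulate (λ x → does (P? x))

  ∈-decSubset⁺ : ∀ {x} → P x → x ∈ decSubset
  ∈-decSubset⁺ {x} P-x = lookup⇒[]= x decSubset
    (trans (lookup∘tabulate _ x) (dec-true (P? x) P-x))

  ∈-decSubset⁻ : ∀ x → x ∈ decSubset → P x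
  ∈-decSubset⁻ x x∈ with P? x | trans (sym (lookup∘tabulate _ x)) ([]=⇒lookup x∈)
  ... | yes P-x | _ = P-x

∣p∣≥n : ∀ {n} {p : Subset n} → (∀ x → x ∈ p) → n ≤ ∣ p ∣
∣p∣≥n {n} {p} full = subst (_≤ ∣ p ∣) (∣⊤∣≡n n) (p⊆q⇒∣p∣≤∣q∣ {p = ⊤} (λ {x} _ → full x))

p⊆∁q⇒∣p∣+∣q∣≤n : ∀ {n} {p q : Subset n} → p ⊆ ∁ q → ∣ p ∣ + ∣ q ∣ ≤ n
p⊆∁q⇒∣p∣+∣q∣≤n {n} {p} {q} p⊆∁q = begin
  ∣ p ∣ + ∣ q ∣     ≤⟨ +-monoˡ-≤ ∣ q ∣ (p⊆q⇒∣p∣≤∣q∣ p⊆∁q) ⟩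
  ∣ ∁ q ∣ + ∣ q ∣   ≡⟨ cong (_+ ∣ q ∣) (∣∁p∣≡n∸∣p∣ q) ⟩
  n ∸ ∣ q ∣ + ∣ q ∣ ≡⟨ m∸n+n≡m (∣p∣≤n q) ⟩
  n                 ∎
  where open ≤-Reasoning

m+n≤o+o∧o<n⇒m<o : ∀ {m n o} → m + n ≤ o + o → o < n → m < o
m+n≤o+o∧o<n⇒m<o {m} {n} {o} m+n≤o+o o<n =
  +-cancelʳ-< o m o (<-≤-trans (+-monoʳ-< m o<n) m+n≤o+o)

module RankCuts {n : ℕ} (G : Graph n) (L : Labeling G) (cuhl : IsCuHL G L)
  (rk : Fin n → ℕ) (rk-injective : Injective _≡_ _≡_ rk)
  (rk-mono : ∀ u v → u ∈ L v → rk v ≤ rk u) where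

  -- The hub on a path to u that ranks below u can only be u itself.
  hub-of-top : ∀ {x u} → WalkWithin G (λ z → rk z ≤ rk u) x u → u ∈ L x
  hub-of-top {x} {u} (w , ranks≤) with walk⇒path G w ranks≤
  ... | P , P-path , P-ranks≤ with cuhl x u P P-path
  ...   | h , h∈Lx , h∈Lu , h∈P = subst (_∈ L x) h≡u h∈Lx
    where
      h≡u : h ≡ u
      h≡u = rk-injective (≤-antisym (All.lookup P-ranks≤ h∈P) (rk-mono h u h∈Lu))

  upper : ℕ → Subset n
  upper r = decSubset (λ u → r ≤? rk u)

  ∈-upper⁺ : ∀ {r u} → r ≤ rk u → u ∈ upper r
  ∈-upper⁺ {r} = ∈-decSubset⁺ (λ u → r ≤? rk u)

  ∈-upper⁻ : ∀ {r u} → u ∈ upper r → r ≤ rk u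
  ∈-upper⁻ {r} {u} = ∈-decSubset⁻ (λ u → r ≤? rk u) u

  ∉-upper⁻ : ∀ {r u} → u ∉ upper (suc r) → rk u ≤ r
  ∉-upper⁻ u∉U = ≤-pred (≰⇒> (λ r<rk → u∉U (∈-upper⁺ r<rk)))

  module _ (p q : ℕ) (q≤p+p : q ≤ p + p) where

    n*q≤p+pn : n * q ≤ p * n + p * n
    n*q≤p+pn = subst (n * q ≤_) n*[p+p]≡pn+pn (*-monoʳ-≤ n q≤p+p)
      where
        open ≡-Reasoning
        n*[p+p]≡pn+pn : n * (p + p) ≡ p * n + p * n
        n*[p+p]≡pn+pn = begin
          n * (p + p)     ≡⟨ *-distribˡ-+ n p p ⟩
          n * p + n * p   ≡⟨ cong (λ m → m + m) (*-comm n p) ⟩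
          p * n + p * n   ∎

    module BigComponent (r : ℕ) (upper-r-balanced : IsBalancedSep G p q (upper r))
      {v₀ : Fin n} (K : Subset n)
      (K-connected : ∀ u → u ∈ K → ConnectedAvoiding G (upper (suc r)) v₀ u)
      (K-big : p * n < ∣ K ∣ * q) {x : Fin n} (x∈K : x ∈ K) where

      Comp : Fin n → Set
      Comp = ConnectedAvoiding G (upper (suc r)) x

      K⊆Comp : ∀ {k} → k ∈ K → Comp k
      K⊆Comp k∈K = within-trans G (within-sym G (K-connected _ x∈K)) (K-connected _ k∈K)

      Comp-extend : ∀ {z z′} → Comp z → Adj G z z′ → z′ ∉ L x → Comp z′
      Comp-extend {z′ = z′} x⇝z a z′∉Lx with z′ ∈? upper (suc r)
      ... | no  z′∉U = within-∷ʳ G x⇝z a z′∉U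
      ... | yes z′∈U = ⊥-elim (z′∉Lx (hub-of-top
              (within-∷ʳ G (within-map G (λ z∉U → <⇒≤ (≤-<-trans (∉-upper⁻ z∉U) (∈-upper⁻ z′∈U))) x⇝z)
                a ≤-refl)))

      Comp∖Lx-below-r : ∀ {z} → Comp z → z ∉ L x → z ∉ upper r
      Comp∖Lx-below-r x⇝z z∉Lx z∈U =
        z∉Lx (hub-of-top (within-map G (λ z′∉U → ≤-trans (∉-upper⁻ z′∉U) (∈-upper⁻ z∈U)) x⇝z))

      near-component : ∀ {y} → Comp y → y ∉ L x → (D : Subset n) →
        (∀ u → u ∈ D → ConnectedAvoiding G (L x) y u) → ∣ D ∣ * q ≤ p * n
      near-component x⇝y y∉Lx D D-connected =
        upper-r-balanced _ (Comp∖Lx-below-r x⇝y y∉Lx) D λ u u∈D →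
          let (w , w∉Lx) = D-connected u u∈D
          in w , All.zipWith (λ (x⇝z , z∉Lx) → Comp∖Lx-below-r x⇝z z∉Lx)
                   (within-propagate G Comp-extend x⇝y w w∉Lx , w∉Lx)

      far-component : ∀ {y} → ¬ Comp y → (D : Subset n) →
        (∀ u → u ∈ D → ConnectedAvoiding G (L x) y u) → ∣ D ∣ * q ≤ p * n
      far-component {y} ¬x⇝y D D-connected = <⇒≤ (m+n≤o+o∧o<n⇒m<o (begin
          ∣ D ∣ * q + ∣ K ∣ * q  ≡⟨ *-distribʳ-+ q ∣ D ∣ ∣ K ∣ ⟨
          (∣ D ∣ + ∣ K ∣) * q    ≤⟨ *-monoˡ-≤ q (p⊆∁q⇒∣p∣+∣q∣≤n D⊆∁K) ⟩
          n * q                  ≤⟨ n*q≤p+pn ⟩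
          p * n + p * n          ∎) K-big)
        where
          open ≤-Reasoning
          D⊆∁K : D ⊆ ∁ K
          D⊆∁K {u} u∈D = x∉p⇒x∈∁p λ u∈K →
            let (w , w∉Lx) = within-sym G (D-connected u u∈D)
            in ¬x⇝y (within-last G w (within-propagate G Comp-extend (K⊆Comp u∈K) w w∉Lx))

      label-balanced : IsBalancedSep G p q (L x)
      label-balanced y y∉Lx D D-connected =
        decidable-stable (_ ≤? _) λ D-big → ¬¬-excluded-middle λ where
          (yes x⇝y) → D-big (near-component x⇝y y∉Lx D D-connected)
          (no ¬x⇝y) → D-big (far-component ¬x⇝y D D-connected)

    module _ (S : Subset n) (S-small : ∣ S ∣ * q < p * n)
      (S-big-labels : ∀ x → IsBalancedSep G p q (L x) → x ∈ S) where

      upper-suc-balanced : ∀ r → IsBalancedSep G p q (upper r) → IsBalancedSep G p q (upper (suc r))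
      upper-suc-balanced r upper-r-balanced v₀ _ K K-connected =
        decidable-stable (_ ≤? _) λ K-big → <-irrefl refl (begin-strict
          p * n   <⟨ ≰⇒> K-big ⟩
          ∣ K ∣ * q ≤⟨ *-monoˡ-≤ q (p⊆q⇒∣p∣≤∣q∣ (K⊆S (≰⇒> K-big))) ⟩
          ∣ S ∣ * q <⟨ S-small ⟩
          p * n   ∎)
        where
          open ≤-Reasoning
          K⊆S : p * n < ∣ K ∣ * q → K ⊆ S
          K⊆S K-big x∈K = S-big-labels _
            (BigComponent.label-balanced r upper-r-balanced K K-connected K-big x∈K)

      upper-balanced : ∀ r → IsBalancedSep G p q (upper r)
      upper-balanced zero    v v∉U = ⊥-elim (v∉U (∈-upper⁺ z≤n))
      upper-balanced (suc r) = upper-suc-balanced r (upper-balanced r)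

1+q≤p+p : ∀ p q → 2 * suc q ≤ 3 * p → suc q ≤ p + p
1+q≤p+p p q 2[1+q]≤3p = *-cancelˡ-≤ 2 (≤-trans 2[1+q]≤3p 3p≤2[p+p])
  where
    3p≤2[p+p] : 3 * p ≤ 2 * (p + p)
    3p≤2[p+p] = subst (3 * p ≤_) (sym (*-distribˡ-+ 2 p p)) (+-monoˡ-≤ (2 * p) (m≤m+n p (1 * p)))

mainTheorem7 : ∀ {n} (G : Graph n) (L : Labeling G) → IsHCuHL G L →
    ∀ (p q : ℕ) → 2 * suc q ≤ 3 * p → p ≤ suc q →
    ∀ (b : ℕ) → IsMinBalSepSize G p (suc q) b →
    Σ (Subset n) λ C → p * n ≤ ∣ C ∣ * suc q × (∀ v → v ∈ C → b ≤ ∣ L v ∣)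
mainTheorem7 {n} G L (cuhl , π , (π-injective , _) , π-mono) p q 2[1+q]≤3p p≤1+q b (_ , b-minimal) =
  C , decidable-stable (_ ≤? _) C-large , ∈-decSubset⁻ large-label?
  where
    open RankCuts G L cuhl (λ u → toℕ (π u)) (λ eq → π-injective (toℕ-injective eq)) π-mono
    large-label? : Decidable (λ v → b ≤ ∣ L v ∣)
    large-label? v = b ≤? ∣ L v ∣
    C : Subset n
    C = decSubset large-label?
    C-large : ¬ ¬ (p * n ≤ ∣ C ∣ * suc q)
    C-large C-small = C-small (begin
      p * n       ≤⟨ *-monoˡ-≤ n p≤1+q ⟩
      suc q * n   ≡⟨ *-comm (suc q) n ⟩
      n * suc q   ≤⟨ *-monoˡ-≤ (suc q) (∣p∣≥n {p = C} C-full) ⟩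
      ∣ C ∣ * suc q ∎)
      where
        open ≤-Reasoning
        upper-n-balanced : IsBalancedSep G p (suc q) (upper n)
        upper-n-balanced = upper-balanced p (suc q) (1+q≤p+p p q 2[1+q]≤3p) C (≰⇒> C-small)
          (λ x L-balanced → ∈-decSubset⁺ large-label? (b-minimal (L x) L-balanced)) n
        upper-n-empty : ∀ {v} → upper n ⊆ L v
        upper-n-empty {_} {u} u∈U = ⊥-elim (<⇒≱ (toℕ<n (π u)) (∈-upper⁻ u∈U))
        C-full : ∀ v → v ∈ C
        C-full v = ∈-decSubset⁺ large-label? (≤-trans (b-minimal _ upper-n-balanced) (p⊆q⇒∣p∣≤∣q∣ upper-n-empty))
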